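{- Let $\mathcal{G}$ be a playable $p$-periodic temporal graph with arena $\mathcal{D}$. (i) If $\mathcal{G}$ is sourceless, then every temporal node of $\mathcal{D}$ is anchored. (ii) If $\mathcal{G}$ is reflexive and temporally connected, and some augmented arena $\mathcal{A}$ of $\mathcal{D}$ contains a star (a temporal node $(t,u)$ with $\Gamma_t(u,\mathcal{A})=V$), then every temporal node $(t,u)$ of $\mathcal{A}^*$ is an anchored star of $\mathcal{A}^*$, i.e. is anchored and satisfies $\Gamma_t(u,\mathcal{A}^*)=V$.
   Context: Let $V$ be a finite set of $n$ vertices and $p\ge 1$ an integer. A $p$-periodic temporal graph $\mathcal{G}=(G_0,\dots,G_{p-1})^*$ is the infinite sequence of directed graphs whose snapshot at time $t\in\{0,1,2,\dots\}$ is $G_{t\bmod p}=(V,E_{t\bmod p})$, where each $E_i\subseteq V\times V$ may contain self-loops. It is playable if in every $G_i$ every vertex has at least one outgoing edge. $\mathcal{G}$ is sourceless if in every $G_i$ every vertex has at least one incoming edge, and reflexive if every $G_i$ contains all self-loops $(u,u)$. A journey from $x$ to $y$ starting at time $t$ is a sequence $(z_0,z_1),(z_1,z_2),\dots,(z_{k-1},z_k)$ with $z_0=x$, $z_k=y$ and $(z_i,z_{i+1})\in E_{(t+i)\bmod p}$; $\mathcal{G}$ is temporally connected if for all $u,v\in V$ and every time $t$ there is a journey from $u$ to $v$ starting at time $t$. Slice indices are taken modulo $p$. An arena of length $p$ on $V$ is a directed graph with vertex set $\mathbb{Z}_p\times V$ (temporal nodes) all of whose edges have the form $((i,w),(i+1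 \bmod p,w'))$. The arena of $\mathcal{G}$ is the arena $\mathcal{D}$ with $((i,u),(i+1,v))\in E(\mathcal{D})$ iff $(u,v)\in E_i$. For an arena $\mathcal{A}$ write $\Gamma_t(u,\mathcal{A})=\{v\in V:((t,u),(t+1,v))\in E(\mathcal{A})\}$. A temporal node $(t,u)$ is anchored if there is a directed walk in $\mathcal{D}$ (possibly of length zero) from some temporal node $(0,v)$ to $(t,u)$. Game (one cop, one robber, restless, full information): in each round $t$, first the cop moves from its vertex $c$ to some $c'\in\Gamma_{t\bmod p}(c,\mathcal{D})$, then the robber moves from its vertex $r$ to some $r'\in\Gamma_{t\bmod p}(r,\mathcal{D})$. The cop wins if it moves onto the vertex currently occupied by the robber (both on the same vertex counts as capture); the robber wins by avoiding capture forever. A configuration $(t,c,r)$ (cop at $c$, robber at $r$ at the start of round $t$, cop to move) is copwin if the cop has a strategy guaranteeing capture from it; this depends only on $t\bmod p$. An augmented arena of $\mathcal{D}$ is an arena $\mathcal{A}$ with $E(\mathcal{D})\subseteq E(\mathcal{A})$ such that for every edge $((t,x),(t+1,y))\in E(\mathcal{A})$ the configuration $(t,x,y)$ is copwin; augmented arenas are closed under union of edge sets and $\mathcal{A}^*$ denotes the one with the largest edge set. -}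

module Defs where

open import Data.Nat using (ℕ; zero; suc; NonZero)
open import Data.Nat.DivMod using (_mod_)
open import Data.Fin using (Fin; toℕ)
open import Data.Bool using (Bool; true)
open import Data.Product using (Σ; ∃; _×_)
open import Data.Sum using (_⊎_)
open import Relation.Binary.PropositionalEquality using (_≡_)

-- Vertex set V = Fin n, slice indices Fin p (= ℤ_p).
-- An arena of length p on V: edge ((i,w),(i+1 mod p,w')) present iff A i w w' ≡ true.
-- A p-periodic temporal graph (G_0,…,G_{p-1})* is given by its snapshots E,
-- with (u,v) ∈ E_i iff E i u v ≡ true; its arena is the same data.
Arena : ℕ → ℕ → Set
Arena n p = Fin p → Fin n → Fin n → Bool

module _ {n p : ℕ} {{nz : NonZero p}} where

  time0 : Fin p
  time0 = 0 mod p

  next : Fin p → Fin p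
  next i = suc (toℕ i) mod p

  Playable : Arena n p → Set
  Playable E = ∀ i u → ∃ λ v → E i u v ≡ true

  Sourceless : Arena n p → Set
  Sourceless E = ∀ i v → ∃ λ u → E i u v ≡ true

  Reflexive : Arena n p → Set
  Reflexive E = ∀ i u → E i u u ≡ true

  data Journey (E : Arena n p) : Fin p → Fin n → Fin n → Set where
    jnil  : ∀ {t x} → Journey E t x x
    jcons : ∀ {t x z y} → E t x z ≡ true → Journey E (next t) z y → Journey E t x y

  TemporallyConnected : Arena n p → Set
  TemporallyConnected E = ∀ (t : ℕ) u v → Journey E (t mod p) u v

  data Walk (A : Arena n p) : Fin p → Fin n → Fin p → Fin n → Set where
    wnil  : ∀ {i w} → Walk A i w i w
    wcons : ∀ {i w w' j w''} → A i w w' ≡ true → Walk A (next i) w' j w'' → Walk A i w j w''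

  Anchored : Arena n p → Fin p → Fin n → Set
  Anchored D t u = ∃ λ v → Walk D time0 v t u

  -- Copwin configurations (t,c,r) of the restless one-cop game on D
  -- (least fixed point / attractor: cop can force capture).
  data CopWin (D : Arena n p) : Fin p → Fin n → Fin n → Set where
    caught : ∀ {t c} → CopWin D t c c
    move   : ∀ {t c r} (c' : Fin n) → D t c c' ≡ true →
             (c' ≡ r ⊎ (∀ r' → D t r r' ≡ true → CopWin D (next t) c' r')) →
             CopWin D t c r

  IsAugmented : Arena n p → Arena n p → Set
  IsAugmented D A =
    (∀ t x y → D t x y ≡ true → A t x y ≡ true) ×
    (∀ t x y → A t x y ≡ true → CopWin D t x y)

  IsLargestAugmented : Arena n p → Arena n p → Set
  IsLargestAugmented D A =
    IsAugmented D A × (∀ B → IsAugmented D B → ∀ t x y → B t x y ≡ true → A t x y ≡ true)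

  IsStar : Arena n p → Fin p → Fin n → Set
  IsStar A t u = ∀ v → A t u v ≡ true

module Submission where

-- (i) Walking backwards along incoming edges from (t,u) reaches slice 0 after t steps.
-- (ii) From any configuration (t,x,y) the cop follows a journey from x to the
-- centre u₀ of the star (temporal connectivity), waits on u₀'s self-loop until
-- slice t₀ (reflexivity), and from (t₀,u₀) captures any robber, since every
-- edge of an augmented arena leads to a copwin configuration. So every
-- configuration is copwin, the complete arena is augmented, and A* is complete.
-- Reflexivity also gives sourcelessness, whence anchoring by (i).

open import Defs
open import Data.Nat using (ℕ; NonZero; zero; suc; _+_; _*_; _∸_; _%_)
open import Data.Nat.Properties using (+-identityʳ; +-suc; <⇒≤; ≤-trans; m≤n+m; m+[n∸m]≡n)
open import Data.Nat.DivMod using (_mod_; _/_; m%n<n; m<n⇒m%n≡m; m≡m%n+[m/n]*n; [m+n]%n≡m%n; [m+kn]%n≡m%n)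
open import Data.Fin using (Fin; toℕ)
open import Data.Fin.Properties using (toℕ<n; toℕ-fromℕ<; fromℕ<-cong; fromℕ<-toℕ)
open import Data.Bool using (true)
open import Data.Product using (∃; _×_; _,_)
open import Data.Sum using (inj₂)
open import Relation.Binary.PropositionalEquality
  using (_≡_; refl; sym; trans; cong; subst; subst₂; module ≡-Reasoning)

module _ {p : ℕ} {{_ : NonZero p}} where

  mod-cong : ∀ {a b} → a % p ≡ b % p → a mod p ≡ b mod p
  mod-cong {a} {b} eq = fromℕ<-cong (a % p) (b % p) eq (m%n<n a p) (m%n<n b p)

  toℕ-mod : ∀ (t : Fin p) → toℕ t mod p ≡ t
  toℕ-mod t = trans (fromℕ<-cong _ _ (m<n⇒m%n≡m (toℕ<n t)) (m%n<n (toℕ t) p) (toℕ<n t))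
                    (fromℕ<-toℕ t (toℕ<n t))

  next-mod : ∀ {n} k → next {n} (k mod p) ≡ suc k mod p
  next-mod k = mod-cong (begin
    suc (toℕ (k mod p)) % p      ≡⟨ cong (λ m → suc m % p) (toℕ-fromℕ< (m%n<n k p)) ⟩
    suc (k % p) % p              ≡⟨ [m+kn]%n≡m%n (suc (k % p)) (k / p) p ⟨
    suc (k % p + k / p * p) % p  ≡⟨ cong (λ m → suc m % p) (m≡m%n+[m/n]*n k p) ⟨
    suc k % p                    ∎)
    where open ≡-Reasoning

module _ {n p : ℕ} {{_ : NonZero p}} {A : Arena n p} where

  infixr 5 _++ʷ_

  _++ʷ_ : ∀ {i w j w′ k w″} → Walk A i w j w′ → Walk A j w′ k w″ → Walk A i w k w″
  wnil       ++ʷ q = q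
  wcons e w  ++ʷ q = wcons e (w ++ʷ q)

  step-mod : ∀ {k x y} → A (k mod p) x y ≡ true → Walk A (k mod p) x (suc k mod p) y
  step-mod {k} e = subst (λ t → Walk A (k mod p) _ t _) (next-mod {n = n} k) (wcons e wnil)

  journey⇒walk : ∀ {t x y} → Journey A t x y → ∃ λ t′ → Walk A t x t′ y
  journey⇒walk jnil = _ , wnil
  journey⇒walk (jcons e j) with journey⇒walk j
  ... | t′ , w = t′ , wcons e w

module _ {n p : ℕ} {{_ : NonZero p}} (D : Arena n p) where

  sourceless⇒anchored-mod : Sourceless D → ∀ k u → Anchored D (k mod p) u
  sourceless⇒anchored-mod s zero    u = u , wnil
  sourceless⇒anchored-mod s (suc k) u with s (k mod p) u
  ... | w , e with sourceless⇒anchored-mod s k w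
  ... | v , walk = v , walk ++ʷ step-mod e

  sourceless⇒anchored : Sourceless D → ∀ t u → Anchored D t u
  sourceless⇒anchored s t u =
    subst (λ t → Anchored D t u) (toℕ-mod t) (sourceless⇒anchored-mod s (toℕ t) u)

  reflexive⇒sourceless : Reflexive D → Sourceless D
  reflexive⇒sourceless r i v = v , r i v

  reflexive⇒stay-mod : Reflexive D → ∀ u k d → Walk D (k mod p) u ((k + d) mod p) u
  reflexive⇒stay-mod r u k zero    = subst (λ m → Walk D (k mod p) u (m mod p) u) (sym (+-identityʳ k)) wnil
  reflexive⇒stay-mod r u k (suc d) =
    subst (λ m → Walk D (k mod p) u (m mod p) u) (sym (+-suc k d))
      (reflexive⇒stay-mod r u k d ++ʷ step-mod (r ((k + d) mod p) u))

  reflexive⇒stay : Reflexive D → ∀ s t u → Walk D s u t u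
  reflexive⇒stay r s t u =
    subst₂ (λ s t → Walk D s u t u) (toℕ-mod s) arrives (reflexive⇒stay-mod r u (toℕ s) (m ∸ toℕ s))
    where
    -- wait until the absolute time toℕ t + p, which is past toℕ s and lies in slice t
    m : ℕ
    m = toℕ t + p

    arrives : (toℕ s + (m ∸ toℕ s)) mod p ≡ t
    arrives = trans (mod-cong (trans (cong (_% p) (m+[n∸m]≡n (≤-trans (<⇒≤ (toℕ<n s)) (m≤n+m p (toℕ t)))))
                                     ([m+n]%n≡m%n (toℕ t) p)))
                    (toℕ-mod t)

  walk⇒copWin : ∀ {t x t′ c} → Walk D t x t′ c → (∀ r → CopWin D t′ c r) → ∀ r → CopWin D t x r
  walk⇒copWin wnil        win r = win r
  walk⇒copWin (wcons e w) win r = move _ e (inj₂ λ r′ _ → walk⇒copWin w win r′)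

  star⇒copWin : ∀ {A t u} → IsAugmented D A → IsStar A t u → ∀ r → CopWin D t u r
  star⇒copWin (_ , aug) star r = aug _ _ r (star r)

  star⇒everywhere-copWin : ∀ {A t₀ u₀} → Reflexive D → TemporallyConnected D →
                           IsAugmented D A → IsStar A t₀ u₀ → ∀ t x y → CopWin D t x y
  star⇒everywhere-copWin {t₀ = t₀} {u₀} r tc aug star t x
    with journey⇒walk (subst (λ s → Journey D s x u₀) (toℕ-mod t) (tc (toℕ t) x u₀))
  ... | t′ , journey = walk⇒copWin (journey ++ʷ reflexive⇒stay r t′ t₀ u₀) (star⇒copWin aug star)

  complete : Arena n p
  complete _ _ _ = true

  everywhere-copWin⇒complete-isAugmented : (∀ t x y → CopWin D t x y) → IsAugmented D complete
  everywhere-copWin⇒complete-isAugmented win = (λ _ _ _ _ → refl) , λ t x y _ → win t x y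

  everywhere-copWin⇒largest-isStar : ∀ {A*} → IsLargestAugmented D A* →
                                     (∀ t x y → CopWin D t x y) → ∀ t u → IsStar A* t u
  everywhere-copWin⇒largest-isStar (_ , largest) win t u v =
    largest complete (everywhere-copWin⇒complete-isAugmented win) t u v refl

mainTheorem7 : (n p : ℕ) {{nz : NonZero p}} (D : Arena n p) → Playable D →
    ((Sourceless D → ∀ (t : Fin p) (u : Fin n) → Anchored D t u) ×
     (Reflexive D → TemporallyConnected D →
       (∃ λ A → IsAugmented D A × ∃ λ (t : Fin p) → ∃ λ (u : Fin n) → IsStar A t u) →
       ∀ Astar → IsLargestAugmented D Astar →
       ∀ (t : Fin p) (u : Fin n) → Anchored D t u × IsStar Astar t u))
mainTheorem7 n p D _ = sourceless⇒anchored D , starsEverywhere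
  where
  starsEverywhere : Reflexive D → TemporallyConnected D →
    (∃ λ A → IsAugmented D A × ∃ λ (t : Fin p) → ∃ λ (u : Fin n) → IsStar A t u) →
    ∀ Astar → IsLargestAugmented D Astar →
    ∀ (t : Fin p) (u : Fin n) → Anchored D t u × IsStar Astar t u
  starsEverywhere r tc (A , aug , t₀ , u₀ , star) Astar largest t u =
    sourceless⇒anchored D (reflexive⇒sourceless D r) t u ,
    everywhere-copWin⇒largest-isStar D largest (star⇒everywhere-copWin D r tc aug star) t u
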